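{- Let $N$ be a network on $X$ containing no $3$-alternating cycle, and let $Y\subseteq X$ with $|Y|\ge2$. Then $Y$ is a clique in $\mathcal A(N)$ if and only if some vertex of $N$ is an ancestor of all leaves in $Y$.
   Context: In a digraph, a leaf is a vertex of indegree 1 and outdegree 0, a root is a vertex of indegree 0. A network on $X$ ($|X|\ge2$) is a simple acyclic digraph $N$ whose underlying undirected graph is connected, whose set of leaves is $X$, in which every vertex of indegree 0 has outdegree at least 2, every vertex of outdegree 0 has indegree 1, and no vertex has both indegree and outdegree equal to 1. $v$ is an ancestor of $w$ if there is a directed path (possibly of length 0) from $v$ to $w$. $\mathcal A(N)$ is the graph on $X$ with distinct $x,y$ adjacent iff some vertex is an ancestor of both. A clique is a set of at least 2 pairwise adjacent vertices. A hybrid vertex has indegree at least 2. A $3$-alternating cycle is a sequence $v_1,h_1,v_2,h_2,v_3,h_3$ of vertices such that for each $i\in\{1,2,3\}$, $h_i$ is a hybrid vertex and there are internally vertex-disjoint directed paths from $v_i$ to $h_i$ and from $v_{i+1}$ to $h_i$ (with $v_4=v_1$). -}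

module Defs where

open import Data.Nat using (ℕ; _≤_)
open import Data.Bool using (Bool; true; false; if_then_else_)
open import Data.Fin using (Fin)
open import Data.Fin.Subset using (Subset; _∈_; ∣_∣)
open import Data.List using (List; []; _∷_; map; allFin)
open import Data.Nat.ListAction using (sum)
open import Data.List.Relation.Binary.Disjoint.Propositional using (Disjoint)
open import Data.List.Relation.Unary.Unique.Propositional using (Unique)
open import Data.Product using (Σ; _×_; ∃; ∃-syntax)
open import Data.Sum using (_⊎_)
open import Data.Empty using (⊥)
open import Relation.Nullary using (¬_)
open import Relation.Binary.PropositionalEquality using (_≡_; _≢_)
open import Relation.Binary.Construct.Closure.ReflexiveTransitive using (Star)

-- A digraph on the vertex set Fin n, given by a Boolean adjacency matrix:
-- there is an arc u → v iff  E u v ≡ true.  (Hence no multiple arcs.)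
Digraph : ℕ → Set
Digraph n = Fin n → Fin n → Bool

module _ {n : ℕ} (E : Digraph n) where

  Arc : Fin n → Fin n → Set
  Arc u v = E u v ≡ true

  indeg : Fin n → ℕ
  indeg v = sum (map (λ u → if E u v then 1 else 0) (allFin n))

  outdeg : Fin n → ℕ
  outdeg u = sum (map (λ v → if E u v then 1 else 0) (allFin n))

  IsLeafD : Fin n → Set
  IsLeafD v = indeg v ≡ 1 × outdeg v ≡ 0

  -- acyclic: no arc u → v followed by a directed path back from v to u
  -- (this also excludes loops, so the digraph is simple)
  Acyclic : Set
  Acyclic = ∀ u v → Arc u v → Star Arc v u → ⊥

  UArc : Fin n → Fin n → Set
  UArc u v = Arc u v ⊎ Arc v u

  Connected : Set
  Connected = ∀ u v → Star UArc u v

record Network (n : ℕ) : Set where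
  field
    E          : Digraph n
    acyclic    : Acyclic E
    connected  : Connected E
    -- |X| ≥ 2, where X is the set of leaves
    twoLeaves  : ∃[ x ] ∃[ y ] (x ≢ y × IsLeafD E x × IsLeafD E y)
    rootOut    : ∀ v → indeg E v ≡ 0 → 2 ≤ outdeg E v
    sinkIn     : ∀ v → outdeg E v ≡ 0 → indeg E v ≡ 1
    noDeg11    : ∀ v → ¬ (indeg E v ≡ 1 × outdeg E v ≡ 1)

module _ {n : ℕ} (N : Network n) where
  open Network N

  IsLeaf : Fin n → Set
  IsLeaf = IsLeafD E

  IsHybrid : Fin n → Set
  IsHybrid v = 2 ≤ indeg E v

  Ancestor : Fin n → Fin n → Set
  Ancestor = Star (Arc E)

  -- Directed path from u to w whose list of internal vertices is given
  -- (in an acyclic digraph every such walk is a path).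
  data PathVia : Fin n → Fin n → List (Fin n) → Set where
    trivial : ∀ {u} → PathVia u u []
    arc     : ∀ {u w} → Arc E u w → PathVia u w []
    step    : ∀ {u m w is} → Arc E u m → PathVia m w is → PathVia u w (m ∷ is)

  DisjointPaths : Fin n → Fin n → Fin n → Set
  DisjointPaths u u' h =
    ∃[ is ] ∃[ js ] (PathVia u h is × PathVia u' h js × Disjoint is js)

  Has3AltCycle : Set
  Has3AltCycle =
    ∃[ v₁ ] ∃[ h₁ ] ∃[ v₂ ] ∃[ h₂ ] ∃[ v₃ ] ∃[ h₃ ]
      ( Unique (v₁ ∷ h₁ ∷ v₂ ∷ h₂ ∷ v₃ ∷ h₃ ∷ [])
      × IsHybrid h₁ × IsHybrid h₂ × IsHybrid h₃
      × DisjointPaths v₁ v₂ h₁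
      × DisjointPaths v₂ v₃ h₂
      × DisjointPaths v₃ v₁ h₃ )

  Adj𝒜 : Fin n → Fin n → Set
  Adj𝒜 x y = IsLeaf x × IsLeaf y × x ≢ y × ∃[ v ] (Ancestor v x × Ancestor v y)

  Clique𝒜 : Subset n → Set
  Clique𝒜 Y = 2 ≤ ∣ Y ∣ × (∀ x → x ∈ Y → IsLeaf x)
            × (∀ x y → x ∈ Y → y ∈ Y → x ≢ y → Adj𝒜 x y)

{-# OPTIONS --safe #-}
-- Two vertices u, u', neither an ancestor of the other, with a common
-- descendant y meet at a hybrid: a topmost common descendant h above y is
-- reached from u and u' by internally disjoint paths, whose last arcs enter h
-- from different vertices. So if u₁ is an ancestor of b and c but not of a,
-- u₂ of a and c but not of b, and u₃ of a and b but not of c, then the uᵢ and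
-- the hybrids where they pairwise meet form a 3-alternating cycle. Without
-- such cycles, covering the three pairs of three leaves by ancestors forces a
-- single ancestor of all three (a Helly property), and adding the leaves of a
-- clique one at a time yields a common ancestor of all of them.
module Submission where

open import Defs
open import Data.Nat using (ℕ; zero; suc; _+_; _≤_; _<_; s≤s)
open import Data.Nat.Properties
  using (≤-refl; ≤-trans; <⇒≤; ≤⇒≯; m≤n⇒m≤1+n; +-suc; +-comm; +-monoˡ-≤; +-monoʳ-≤; m≤m+n; m≤n+m; ≰⇒>; _≤?_; module ≤-Reasoning)
open import Data.Fin using (Fin; zero; suc; toℕ)
open import Data.Fin.Properties using (any?; pigeonhole; _≟_)
open import Data.Fin.Subset using (Subset; _∈_; ∣_∣)
open import Data.Fin.Subset.Properties using (_∈?_)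
open import Data.Product using (∃; ∃-syntax; _×_; _,_; proj₁; proj₂; map₂)
open import Data.Sum using (_⊎_; inj₁; inj₂)
open import Data.Empty using (⊥-elim)
open import Data.Bool using (Bool; if_then_else_)
import Data.Bool.Properties as Bool
open import Data.List using (List; []; _∷_; _++_; allFin; filter; tabulate)
open import Data.List.Properties using (map-tabulate)
open import Data.Nat.ListAction using (sum)
open import Data.List.Membership.Propositional using () renaming (_∈_ to _∈ₗ_)
open import Data.List.Membership.Propositional.Properties using (∈-filter⁺; ∈-filter⁻; ∈-allFin)
open import Data.List.Relation.Unary.Any using (here; there)
open import Data.List.Relation.Unary.All as All using (All; []; _∷_)
open import Data.List.Relation.Unary.All.Properties using (++⁻ˡ)
open import Data.List.Relation.Unary.AllPairs using ([]; _∷_)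
open import Data.List.Relation.Unary.Unique.Propositional using (Unique)
open import Data.List.Relation.Binary.Permutation.Propositional.Properties using (All-resp-↭; shift)
open import Relation.Nullary using (¬_; Dec; yes; no)
open import Relation.Nullary.Decidable using (_×-dec_; _⊎-dec_)
open import Relation.Unary using (Decidable)
open import Relation.Binary.PropositionalEquality using (_≡_; _≢_; refl; sym; cong; cong₂; subst; ≢-sym)
open import Relation.Binary.Construct.Closure.ReflexiveTransitive using (Star; ε; _◅_; _◅◅_)
open import Function using (_∘_; id)
open import Function.Bundles using (_⇔_; mk⇔)

≤-sum-tabulate : ∀ {m} (g : Fin m → ℕ) p → g p ≤ sum (tabulate g)
≤-sum-tabulate g zero    = m≤m+n _ _
≤-sum-tabulate g (suc p) = ≤-trans (≤-sum-tabulate (g ∘ suc) p) (m≤n+m _ _)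

+-≤-sum-tabulate : ∀ {m} (g : Fin m → ℕ) {p q} → p ≢ q → g p + g q ≤ sum (tabulate g)
+-≤-sum-tabulate g {zero}  {zero}  p≢q = ⊥-elim (p≢q refl)
+-≤-sum-tabulate g {zero}  {suc q} _   = +-monoʳ-≤ (g zero) (≤-sum-tabulate (g ∘ suc) q)
+-≤-sum-tabulate g {suc p} {zero}  _   =
  subst (_≤ sum (tabulate g)) (+-comm (g zero) (g (suc p)))
        (+-monoʳ-≤ (g zero) (≤-sum-tabulate (g ∘ suc) p))
+-≤-sum-tabulate g {suc p} {suc q} p≢q =
  ≤-trans (+-≤-sum-tabulate (g ∘ suc) (p≢q ∘ cong suc)) (m≤n+m _ _)

2≤indeg : ∀ {n} (E : Digraph n) {z₁ z₂ h} → z₁ ≢ z₂ → Arc E z₁ h → Arc E z₂ h → 2 ≤ indeg E h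
2≤indeg {n} E {z₁} {z₂} {h} z₁≢z₂ a₁ a₂ = begin
  2                          ≡⟨ cong₂ _+_ (cong indicator (sym a₁)) (cong indicator (sym a₂)) ⟩
  g z₁ + g z₂                ≤⟨ +-≤-sum-tabulate g z₁≢z₂ ⟩
  sum (tabulate g)           ≡⟨ cong sum (map-tabulate id g) ⟨
  indeg E h                  ∎
  where
    open ≤-Reasoning
    indicator : Bool → ℕ
    indicator b = if b then 1 else 0
    g : Fin n → ℕ
    g u = indicator (E u h)

module Paths {n} (E : Digraph n) (acyclic : Acyclic E) where

  infix 4 _⇝_ _⇝⁺_ _⇝?_ _⇝⁺?_

  _⇝_ : Fin n → Fin n → Set
  _⇝_ = Star (Arc E)

  _⇝⁺_ : Fin n → Fin n → Set
  u ⇝⁺ v = ∃ λ w → Arc E u w × w ⇝ v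

  length : ∀ {u v} → u ⇝ v → ℕ
  length ε       = 0
  length (_ ◅ p) = suc (length p)

  length-suffix : ∀ {u v w} (p : u ⇝ v) (q : v ⇝ w) → length q ≤ length (p ◅◅ q)
  length-suffix ε       q = ≤-refl
  length-suffix (_ ◅ p) q = m≤n⇒m≤1+n (length-suffix p q)

  vertex : ∀ {u v} (p : u ⇝ v) → Fin (suc (length p)) → Fin n
  vertex {u} p       zero    = u
  vertex     (_ ◅ p) (suc i) = vertex p i

  prefix : ∀ {u v} (p : u ⇝ v) j → u ⇝ vertex p j
  prefix p       zero    = ε
  prefix (a ◅ p) (suc j) = a ◅ prefix p j

  vertex-⇝⁺ : ∀ {u v} (p : u ⇝ v) i j → toℕ i < toℕ j → vertex p i ⇝⁺ vertex p j
  vertex-⇝⁺ (a ◅ p) zero    (suc j) _         = _ , a , prefix p j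
  vertex-⇝⁺ (_ ◅ p) (suc i) (suc j) (s≤s i<j) = vertex-⇝⁺ p i j i<j

  ⇝⁺-irreflexive : ∀ {u} → ¬ u ⇝⁺ u
  ⇝⁺-irreflexive (w , a , p) = acyclic _ w a p

  -- A path through more than n vertices repeats one, closing a cycle.
  length<n : ∀ {u v} (p : u ⇝ v) → length p < n
  length<n p with suc (length p) ≤? n
  ... | yes p<n = p<n
  ... | no  p≮n with i , j , i<j , same ← pigeonhole (≰⇒> p≮n) (vertex p) =
    ⊥-elim (⇝⁺-irreflexive (subst (_⇝⁺ vertex p j) same (vertex-⇝⁺ p i j i<j)))

  Within : ℕ → Fin n → Fin n → Set
  Within zero    u v = u ≡ v
  Within (suc k) u v = u ≡ v ⊎ ∃ λ w → Arc E u w × Within k w v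

  within? : ∀ k u v → Dec (Within k u v)
  within? zero    u v = u ≟ v
  within? (suc k) u v = u ≟ v ⊎-dec any? (λ w → E u w Bool.≟ _ ×-dec within? k w v)

  within⇒⇝ : ∀ k {u v} → Within k u v → u ⇝ v
  within⇒⇝ zero    refl                 = ε
  within⇒⇝ (suc k) (inj₁ refl)          = ε
  within⇒⇝ (suc k) (inj₂ (_ , a , r)) = a ◅ within⇒⇝ k r

  ⇝⇒within : ∀ k {u v} (p : u ⇝ v) → length p ≤ k → Within k u v
  ⇝⇒within zero    ε       _         = refl
  ⇝⇒within (suc k) ε       _         = inj₁ refl
  ⇝⇒within (suc k) (a ◅ p) (s≤s p≤k) = inj₂ (_ , a , ⇝⇒within k p p≤k)

  _⇝?_ : ∀ u v → Dec (u ⇝ v)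
  u ⇝? v with within? n u v
  ... | yes r = yes (within⇒⇝ n r)
  ... | no ¬r = no λ p → ¬r (⇝⇒within n p (<⇒≤ (length<n p)))

  _⇝⁺?_ : ∀ u v → Dec (u ⇝⁺ v)
  u ⇝⁺? v = any? (λ w → E u w Bool.≟ _ ×-dec w ⇝? v)

  lastArc : ∀ {u v} → u ⇝⁺ v → ∃ λ z → u ⇝ z × Arc E z v
  lastArc (_ , a , p) = go a p
    where
      go : ∀ {u w v} → Arc E u w → w ⇝ v → ∃ λ z → u ⇝ z × Arc E z v
      go a ε       = _ , ε , a
      go a (b ◅ p) with z , w⇝z , z→v ← go b p = z , a ◅ w⇝z , z→v

  ⇝-≢⇒⇝⁺ : ∀ {u v} → u ⇝ v → u ≢ v → u ⇝⁺ v
  ⇝-≢⇒⇝⁺ ε       u≢v = ⊥-elim (u≢v refl)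
  ⇝-≢⇒⇝⁺ (a ◅ p) _   = _ , a , p

  ≢-by-⇝ : ∀ {p x y q} → p ⇝ x → y ⇝ q → ¬ p ⇝ q → x ≢ y
  ≢-by-⇝ p⇝x y⇝q p⇝̸q refl = p⇝̸q (p⇝x ◅◅ y⇝q)

  ¬⇝-by-⇝ : ∀ {u u' x} → ¬ u ⇝ x → u' ⇝ x → ¬ u ⇝ u'
  ¬⇝-by-⇝ u⇝̸x u'⇝x u⇝u' = u⇝̸x (u⇝u' ◅◅ u'⇝x)

  module _ {P : Fin n → Set} (P? : Decidable P) where

    NoneStrictlyAbove : Fin n → Set
    NoneStrictlyAbove m = ∀ {w} → P w → ¬ w ⇝⁺ m

    -- Climbing to a P-vertex strictly above lengthens the path down to h,
    -- which cannot happen n times.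
    topmost : ∀ {h} → P h → ∃ λ m → P m × m ⇝ h × NoneStrictlyAbove m
    topmost {h} Ph = climb n ε (m≤n+m n 0) Ph
      where
        climb : ∀ fuel {m} (p : m ⇝ h) → n ≤ length p + fuel → P m →
                ∃ λ m → P m × m ⇝ h × NoneStrictlyAbove m
        climb zero    p n≤ _ =
          ⊥-elim (≤⇒≯ (subst (n ≤_) (+-comm (length p) 0) n≤) (length<n p))
        climb (suc fuel) {m} p n≤ Pm with any? (λ w → P? w ×-dec w ⇝⁺? m)
        ... | no  none                   = m , Pm , p , λ Pw w⇝⁺m → none (_ , Pw , w⇝⁺m)
        ... | yes (w , Pw , z , a , q) = climb fuel (a ◅ (q ◅◅ p)) n≤′ Pw
          where
            open ≤-Reasoning
            n≤′ : n ≤ length (a ◅ (q ◅◅ p)) + fuel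
            n≤′ = begin
              n                          ≤⟨ n≤ ⟩
              length p + suc fuel        ≡⟨ +-suc (length p) fuel ⟩
              suc (length p) + fuel      ≤⟨ +-monoˡ-≤ fuel (s≤s (length-suffix q p)) ⟩
              length (a ◅ (q ◅◅ p)) + fuel ∎

module _ {n} (N : Network n) where
  open Network N
  open Paths E acyclic

  interior : ∀ {u v} → u ⇝ v → List (Fin n)
  interior ε                        = []
  interior (_ ◅ ε)                  = []
  interior (_◅_ {j = w} _ (b ◅ p)) = w ∷ interior (b ◅ p)

  pathVia-interior : ∀ {u v} (p : u ⇝ v) → PathVia N u v (interior p)
  pathVia-interior ε             = trivial
  pathVia-interior (a ◅ ε)       = arc a
  pathVia-interior (a ◅ (b ◅ p)) = step a (pathVia-interior (b ◅ p))

  ∈-interior : ∀ {u v x} (p : u ⇝ v) → x ∈ₗ interior p → u ⇝ x × x ⇝⁺ v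
  ∈-interior (a ◅ (b ◅ p)) (here refl) = a ◅ ε , _ , b , p
  ∈-interior (a ◅ (b ◅ p)) (there x∈)  with u⇝x , x⇝⁺v ← ∈-interior (b ◅ p) x∈ = a ◅ u⇝x , x⇝⁺v

  -- Take h topmost among the common descendants of u and u' above y: a vertex
  -- shared by both paths, or a shared last in-neighbour of h, would be a
  -- common descendant strictly above h.
  meet-at-hybrid : ∀ {u u' y} → u ⇝ y → u' ⇝ y → ¬ u ⇝ u' → ¬ u' ⇝ u →
    ∃ λ h → u ⇝ h × u' ⇝ h × h ⇝ y × IsHybrid N h × DisjointPaths N u u' h
  meet-at-hybrid {u} {u'} u⇝y u'⇝y u⇝̸u' u'⇝̸u
    with h , (u⇝h , u'⇝h) , h⇝y , top ← topmost (λ w → (u ⇝? w) ×-dec (u' ⇝? w)) (u⇝y , u'⇝y) =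
    h , u⇝h , u'⇝h , h⇝y , hybrid , (_ , _ , pathVia-interior u⇝h , pathVia-interior u'⇝h , disjoint)
    where
      disjoint : ∀ {x} → ¬ (x ∈ₗ interior u⇝h × x ∈ₗ interior u'⇝h)
      disjoint (x∈ , x∈') with u⇝x , x⇝⁺h ← ∈-interior u⇝h x∈ =
        top (u⇝x , proj₁ (∈-interior u'⇝h x∈')) x⇝⁺h

      hybrid : IsHybrid N h
      hybrid with z  , u⇝z  , z→h  ← lastArc (⇝-≢⇒⇝⁺ u⇝h  (≢-sym (≢-by-⇝ u'⇝h ε u'⇝̸u)))
                | z' , u'⇝z' , z'→h ← lastArc (⇝-≢⇒⇝⁺ u'⇝h (≢-sym (≢-by-⇝ u⇝h ε u⇝̸u'))) =
        2≤indeg E z≢z' z→h z'→h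
        where
          z≢z' : z ≢ z'
          z≢z' refl = top (u⇝z , u'⇝z') (h , z→h , ε)

  alternating-cycle : ∀ {u₁ u₂ u₃ a b c} → u₁ ⇝ b → u₁ ⇝ c → u₂ ⇝ a → u₂ ⇝ c → u₃ ⇝ a → u₃ ⇝ b →
    ¬ u₁ ⇝ a → ¬ u₂ ⇝ b → ¬ u₃ ⇝ c → Has3AltCycle N
  alternating-cycle {u₁} {u₂} {u₃} u₁b u₁c u₂a u₂c u₃a u₃b u₁a̸ u₂b̸ u₃c̸
    with h₁ , u₁h₁ , u₂h₁ , _   , hyb₁ , paths₁ ← meet-at-hybrid u₁c u₂c (¬⇝-by-⇝ u₁a̸ u₂a) (¬⇝-by-⇝ u₂b̸ u₁b)
       | h₂ , u₂h₂ , u₃h₂ , h₂a , hyb₂ , paths₂ ← meet-at-hybrid u₂a u₃a (¬⇝-by-⇝ u₂b̸ u₃b) (¬⇝-by-⇝ u₃c̸ u₂c)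
       | h₃ , u₃h₃ , u₁h₃ , h₃b , hyb₃ , paths₃ ← meet-at-hybrid u₃b u₁b (¬⇝-by-⇝ u₃c̸ u₁c) (¬⇝-by-⇝ u₁a̸ u₃a) =
    u₁ , h₁ , u₂ , h₂ , u₃ , h₃ , distinct , hyb₁ , hyb₂ , hyb₃ , paths₁ , paths₂ , paths₃
    where
      distinct : Unique (u₁ ∷ h₁ ∷ u₂ ∷ h₂ ∷ u₃ ∷ h₃ ∷ [])
      distinct = ( ≢-sym (≢-by-⇝ u₂h₁ u₁b u₂b̸)
                 ∷ ≢-by-⇝ ε u₂a u₁a̸
                 ∷ ≢-by-⇝ ε h₂a u₁a̸
                 ∷ ≢-by-⇝ ε u₃a u₁a̸
                 ∷ ≢-sym (≢-by-⇝ u₃h₃ u₁c u₃c̸)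
                 ∷ [] )
               ∷ ( ≢-by-⇝ u₁h₁ u₂a u₁a̸
                 ∷ ≢-by-⇝ u₁h₁ h₂a u₁a̸
                 ∷ ≢-by-⇝ u₁h₁ u₃a u₁a̸
                 ∷ ≢-by-⇝ u₂h₁ h₃b u₂b̸
                 ∷ [] )
               ∷ ( ≢-sym (≢-by-⇝ u₃h₂ u₂c u₃c̸)
                 ∷ ≢-by-⇝ ε u₃b u₂b̸
                 ∷ ≢-by-⇝ ε h₃b u₂b̸
                 ∷ [] )
               ∷ ( ≢-by-⇝ u₂h₂ u₃b u₂b̸
                 ∷ ≢-by-⇝ u₂h₂ h₃b u₂b̸
                 ∷ [] )
               ∷ ( ≢-sym (≢-by-⇝ u₁h₃ u₃a u₁a̸)
                 ∷ [] )
               ∷ []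
               ∷ []

  Covered : List (Fin n) → Set
  Covered xs = ∃ λ v → All (v ⇝_) xs

  three-cover : ¬ Has3AltCycle N → ∀ {a b c K} →
    Covered (b ∷ c ∷ K) → Covered (a ∷ c ∷ K) → Covered (a ∷ b ∷ K) → Covered (a ∷ b ∷ c ∷ K)
  three-cover no-cycle {a} {b} {c} (u₁ , all₁@(u₁b ∷ u₁c ∷ _)) (u₂ , u₂a ∷ u₂c ∷ u₂K) (u₃ , u₃a ∷ u₃b ∷ u₃K)
    with u₁ ⇝? a | u₂ ⇝? b | u₃ ⇝? c
  ... | yes u₁a | _       | _       = u₁ , u₁a ∷ all₁
  ... | no _    | yes u₂b | _       = u₂ , u₂a ∷ u₂b ∷ u₂c ∷ u₂K
  ... | no _    | no _    | yes u₃c = u₃ , u₃a ∷ u₃b ∷ u₃c ∷ u₃K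
  ... | no u₁a̸  | no u₂b̸  | no u₃c̸  = ⊥-elim (no-cycle (alternating-cycle u₁b u₁c u₂a u₂c u₃a u₃b u₁a̸ u₂b̸ u₃c̸))

  -- Generalised over K so that the induction can move a leaf from xs into K.
  helly : ¬ Has3AltCycle N → ∀ xs {K} → Covered K →
    (∀ {x y} → x ∈ₗ xs → y ∈ₗ xs → Covered (x ∷ y ∷ K)) → Covered (xs ++ K)
  helly _        []       cov _     = cov
  helly no-cycle (a ∷ xs) {K} _ pairs =
    map₂ (All-resp-↭ (shift a xs K)) (helly no-cycle xs covered-aK triples)
    where
      covered-aK : Covered (a ∷ K)
      covered-aK with v , _ ∷ v⇝aK ← pairs (here refl) (here refl) = v , v⇝aK

      triples : ∀ {x y} → x ∈ₗ xs → y ∈ₗ xs → Covered (x ∷ y ∷ a ∷ K)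
      triples x∈ y∈ = three-cover no-cycle (pairs (there y∈) (here refl))
                                           (pairs (there x∈) (here refl))
                                           (pairs (there x∈) (there y∈))

lemma4p2 : ∀ {n : ℕ} (N : Network n) → ¬ Has3AltCycle N →
    (Y : Subset n) → (∀ x → x ∈ Y → IsLeaf N x) → 2 ≤ ∣ Y ∣ →
    (Clique𝒜 N Y ⇔ (∃[ v ] (∀ x → x ∈ Y → Ancestor N v x)))
lemma4p2 {n} N no-cycle Y leaves 2≤∣Y∣ = mk⇔ common-ancestor clique
  where
    open Network N

    clique : ∃[ v ] (∀ x → x ∈ Y → Ancestor N v x) → Clique𝒜 N Y
    clique (v , v⇝) = 2≤∣Y∣ , leaves , λ x y x∈ y∈ x≢y →
      leaves x x∈ , leaves y y∈ , x≢y , v , v⇝ x x∈ , v⇝ y y∈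

    members : List (Fin n)
    members = filter (_∈? Y) (allFin n)

    member : ∀ {x} → x ∈ₗ members → x ∈ Y
    member = proj₂ ∘ ∈-filter⁻ (_∈? Y) {xs = allFin n}

    common-ancestor : Clique𝒜 N Y → ∃[ v ] (∀ x → x ∈ Y → Ancestor N v x)
    common-ancestor (_ , _ , adjacent) =
      map₂ (λ v⇝ x x∈ → All.lookup (++⁻ˡ members v⇝) (∈-filter⁺ (_∈? Y) (∈-allFin x) x∈))
           (helly N no-cycle members (proj₁ twoLeaves , []) pair)
      where
        pair : ∀ {x y} → x ∈ₗ members → y ∈ₗ members → Covered N (x ∷ y ∷ [])
        pair {x} {y} x∈ y∈ with x ≟ y
        ... | yes refl = x , ε ∷ ε ∷ []
        ... | no x≢y with _ , _ , _ , v , v⇝x , v⇝y ← adjacent x y (member x∈) (member y∈) x≢y =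
          v , v⇝x ∷ v⇝y ∷ []
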